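{- Let $\mathcal L$ be the linear category of a model of linear logic. Then $\mathop{\mathrm{Inv}}\mathcal L$ is also the linear category of a model of linear logic.
   Context: A model of linear logic consists of: a $\ast$-autonomous category $(\mathcal L,\otimes,1,\bot)$ which also has binary products, written $A\,\&\,B$, and a terminal object $\top$; a Cartesian category $(\mathcal M,\times,T)$; and a linear-non-linear adjunction between them, i.e. a symmetric monoidal adjunction $(L,l,t)\dashv(M,m,u)$ between symmetric monoidal functors $(L,l,t):(\mathcal M,\times,T)\to(\mathcal L,\otimes,1)$ and $(M,m,u):(\mathcal L,\otimes,1)\to(\mathcal M,\times,T)$. The category $\mathcal L$ is called the linear category of the model. For a category $\mathcal A$, an object with involutions is a pair $(A,s)$ with $A$ an object of $\mathcal A$ and $s=(s_k)_{k\in\mathbb Z}$ a $\mathbb Z$-indexed sequence of involutions of $A$ (automorphisms with $s_k\circ s_k=id_A$); a morphism $(A,s)\to(B,t)$ is an arrow $f:A\to B$ of $\mathcal A$ with $t_k\circ f\circ s_k=f$ for all $k$. These form a category $\mathop{\mathrm{Inv}}\mathcal A$ (equivalently, the functor category $\mathcal A^{\mathcal I}$ where $\mathcal I$ is the free Coxeter group on $\mathbb Z$ seen as a one-object groupoid). When $(\mathcal A,\otimes,1)$ is symmetric monoidal, $\mathop{\mathrm{Inv}}\mathcal A$ is symmetric monoidal with $(A,s)\otimes'(B,t)=(A\otimes B,(s_k\otimes t_k)_k)$, unit $(1,(id_1)_k)$, and associator, unitors, symmetry inherited from $\mathcal A$; a functor $F$ acts as $(A,s)\mapsto(FA,(Fs_k)_k)$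 and as $F$ on morphisms, and natural transformations act componentwise. This defines a 2-endofunctor $\mathop{\mathrm{Inv}}$ of the 2-category of symmetric monoidal categories, symmetric monoidal functors and monoidal natural transformations. -}

module Defs where

open import Level using (Level; _⊔_) renaming (suc to lsuc)
open import Data.Integer using (ℤ)
open import Relation.Binary using (Setoid; IsEquivalence)
import Relation.Binary.Reasoning.Setoid as SetoidR

private
  variable
    o ℓ e o' ℓ' e' : Level

record Category (o ℓ e : Level) : Set (lsuc (o ⊔ ℓ ⊔ e)) where
  infix  4 _≈_
  infixr 9 _∘_
  field
    Obj       : Set o
    _⇒_       : Obj → Obj → Set ℓ
    _≈_       : ∀ {A B} → (A ⇒ B) → (A ⇒ B) → Set e
    id        : ∀ {A} → A ⇒ A
    _∘_       : ∀ {A B C} → B ⇒ C → A ⇒ B → A ⇒ C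
    equiv     : ∀ {A B} → IsEquivalence (_≈_ {A} {B})
    ∘-resp-≈  : ∀ {A B C} {f h : B ⇒ C} {g i : A ⇒ B} →
                f ≈ h → g ≈ i → f ∘ g ≈ h ∘ i
    assoc     : ∀ {A B C D} {f : A ⇒ B} {g : B ⇒ C} {h : C ⇒ D} →
                (h ∘ g) ∘ f ≈ h ∘ (g ∘ f)
    identityˡ : ∀ {A B} {f : A ⇒ B} → id ∘ f ≈ f
    identityʳ : ∀ {A B} {f : A ⇒ B} → f ∘ id ≈ f

  hom-setoid : Obj → Obj → Setoid ℓ e
  hom-setoid A B = record { Carrier = A ⇒ B ; _≈_ = _≈_ ; isEquivalence = equiv }

  module HomReasoning {A B : Obj} = SetoidR (hom-setoid A B)

  ≈-refl : ∀ {A B} {f : A ⇒ B} → f ≈ f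
  ≈-refl = IsEquivalence.refl equiv
  ≈-sym : ∀ {A B} {f g : A ⇒ B} → f ≈ g → g ≈ f
  ≈-sym = IsEquivalence.sym equiv
  ≈-trans : ∀ {A B} {f g h : A ⇒ B} → f ≈ g → g ≈ h → f ≈ h
  ≈-trans = IsEquivalence.trans equiv

record Functor (C : Category o ℓ e) (D : Category o' ℓ' e')
       : Set (o ⊔ ℓ ⊔ e ⊔ o' ⊔ ℓ' ⊔ e') where
  private
    module C = Category C
    module D = Category D
  field
    F₀           : C.Obj → D.Obj
    F₁           : ∀ {A B} → A C.⇒ B → F₀ A D.⇒ F₀ B
    identity     : ∀ {A} → F₁ (C.id {A}) D.≈ D.id
    homomorphism : ∀ {X Y Z} {f : X C.⇒ Y} {g : Y C.⇒ Z} →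
                   F₁ (g C.∘ f) D.≈ F₁ g D.∘ F₁ f
    F-resp-≈     : ∀ {A B} {f g : A C.⇒ B} → f C.≈ g → F₁ f D.≈ F₁ g

record Monoidal (C : Category o ℓ e) : Set (o ⊔ ℓ ⊔ e) where
  open Category C
  infixr 10 _⊗₀_ _⊗₁_
  field
    _⊗₀_ : Obj → Obj → Obj
    _⊗₁_ : ∀ {A B C D} → A ⇒ B → C ⇒ D → (A ⊗₀ C) ⇒ (B ⊗₀ D)
    ⊗-identity     : ∀ {A B} → (id {A} ⊗₁ id {B}) ≈ id
    ⊗-homomorphism : ∀ {A B C D E F}
                     {f : A ⇒ B} {g : B ⇒ C} {h : D ⇒ E} {k : E ⇒ F} →
                     ((g ∘ f) ⊗₁ (k ∘ h)) ≈ (g ⊗₁ k) ∘ (f ⊗₁ h)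
    ⊗-resp-≈       : ∀ {A B C D} {f f' : A ⇒ B} {g g' : C ⇒ D} →
                     f ≈ f' → g ≈ g' → (f ⊗₁ g) ≈ (f' ⊗₁ g')
    unit : Obj
    λ⇒ : ∀ {A} → (unit ⊗₀ A) ⇒ A
    λ⇐ : ∀ {A} → A ⇒ (unit ⊗₀ A)
    λ-isoˡ : ∀ {A} → λ⇐ ∘ λ⇒ {A} ≈ id
    λ-isoʳ : ∀ {A} → λ⇒ ∘ λ⇐ {A} ≈ id
    λ-natural : ∀ {A B} {f : A ⇒ B} → λ⇒ ∘ (id ⊗₁ f) ≈ f ∘ λ⇒
    ρ⇒ : ∀ {A} → (A ⊗₀ unit) ⇒ A
    ρ⇐ : ∀ {A} → A ⇒ (A ⊗₀ unit)
    ρ-isoˡ : ∀ {A} → ρ⇐ ∘ ρ⇒ {A} ≈ id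
    ρ-isoʳ : ∀ {A} → ρ⇒ ∘ ρ⇐ {A} ≈ id
    ρ-natural : ∀ {A B} {f : A ⇒ B} → ρ⇒ ∘ (f ⊗₁ id) ≈ f ∘ ρ⇒
    α⇒ : ∀ {A B C} → ((A ⊗₀ B) ⊗₀ C) ⇒ (A ⊗₀ (B ⊗₀ C))
    α⇐ : ∀ {A B C} → (A ⊗₀ (B ⊗₀ C)) ⇒ ((A ⊗₀ B) ⊗₀ C)
    α-isoˡ : ∀ {A B C} → α⇐ ∘ α⇒ {A} {B} {C} ≈ id
    α-isoʳ : ∀ {A B C} → α⇒ ∘ α⇐ {A} {B} {C} ≈ id
    α-natural : ∀ {A A' B B' C C'} {f : A ⇒ A'} {g : B ⇒ B'} {h : C ⇒ C'} →
                α⇒ ∘ ((f ⊗₁ g) ⊗₁ h) ≈ (f ⊗₁ (g ⊗₁ h)) ∘ α⇒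
    triangle : ∀ {A B} → (id {A} ⊗₁ λ⇒ {B}) ∘ α⇒ ≈ (ρ⇒ ⊗₁ id)
    pentagon : ∀ {A B C D} →
               (id {A} ⊗₁ α⇒ {B} {C} {D}) ∘ α⇒ ∘ (α⇒ ⊗₁ id) ≈ α⇒ ∘ α⇒

record Symmetric {C : Category o ℓ e} (M : Monoidal C) : Set (o ⊔ ℓ ⊔ e) where
  open Category C
  open Monoidal M
  field
    σ : ∀ {A B} → (A ⊗₀ B) ⇒ (B ⊗₀ A)
    σ-natural : ∀ {A A' B B'} {f : A ⇒ A'} {g : B ⇒ B'} →
                σ ∘ (f ⊗₁ g) ≈ (g ⊗₁ f) ∘ σ
    σ-involutive : ∀ {A B} → σ {B} {A} ∘ σ {A} {B} ≈ id
    hexagon : ∀ {A B C} →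
              (id {B} ⊗₁ σ {A} {C}) ∘ α⇒ ∘ (σ ⊗₁ id) ≈ α⇒ ∘ σ {A} {B ⊗₀ C} ∘ α⇒

record SymMonCat (o ℓ e : Level) : Set (lsuc (o ⊔ ℓ ⊔ e)) where
  field
    cat       : Category o ℓ e
    monoidal  : Monoidal cat
    symmetric : Symmetric monoidal
  open Category cat public
  open Monoidal monoidal public
  open Symmetric symmetric public

record SymMonFunctor (C : SymMonCat o ℓ e) (D : SymMonCat o' ℓ' e')
       : Set (o ⊔ ℓ ⊔ e ⊔ o' ⊔ ℓ' ⊔ e') where
  private
    module C = SymMonCat C
    module D = SymMonCat D
  field
    F : Functor C.cat D.cat
  open Functor F public
  field
    φ : ∀ {A B} → (F₀ A D.⊗₀ F₀ B) D.⇒ F₀ (A C.⊗₀ B)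
    ε : D.unit D.⇒ F₀ C.unit
    φ-natural : ∀ {A A' B B'} {f : A C.⇒ A'} {g : B C.⇒ B'} →
                φ D.∘ (F₁ f D.⊗₁ F₁ g) D.≈ F₁ (f C.⊗₁ g) D.∘ φ
    associativity : ∀ {A B C} →
      F₁ (C.α⇒ {A} {B} {C}) D.∘ φ D.∘ (φ D.⊗₁ D.id)
        D.≈ φ D.∘ (D.id D.⊗₁ φ) D.∘ D.α⇒
    unitaryˡ : ∀ {A} → F₁ (C.λ⇒ {A}) D.∘ φ D.∘ (ε D.⊗₁ D.id) D.≈ D.λ⇒
    unitaryʳ : ∀ {A} → F₁ (C.ρ⇒ {A}) D.∘ φ D.∘ (D.id D.⊗₁ ε) D.≈ D.ρ⇒
    braiding-compat : ∀ {A B} →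
      F₁ (C.σ {A} {B}) D.∘ φ D.≈ φ D.∘ D.σ

-- Symmetric monoidal adjunctions  (L , l , t) ⊣ (M , m , u)
-- with L : 𝓜 → 𝓛 and M : 𝓛 → 𝓜; unit η and counit ε are monoidal
-- natural transformations  Id ⇒ M L  and  L M ⇒ Id  (the monoidal
-- structure of a composite/identity functor is written out explicitly).

record SymMonAdjunction {𝓜 : SymMonCat o ℓ e} {𝓛 : SymMonCat o' ℓ' e'}
       (L : SymMonFunctor 𝓜 𝓛) (M : SymMonFunctor 𝓛 𝓜)
       : Set (o ⊔ ℓ ⊔ e ⊔ o' ⊔ ℓ' ⊔ e') where
  private
    module 𝓜 = SymMonCat 𝓜
    module 𝓛 = SymMonCat 𝓛
    module L = SymMonFunctor L
    module M = SymMonFunctor M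
  field
    η : ∀ {X} → X 𝓜.⇒ M.F₀ (L.F₀ X)
    ε : ∀ {A} → L.F₀ (M.F₀ A) 𝓛.⇒ A
    η-natural : ∀ {X Y} {f : X 𝓜.⇒ Y} → η 𝓜.∘ f 𝓜.≈ M.F₁ (L.F₁ f) 𝓜.∘ η
    ε-natural : ∀ {A B} {f : A 𝓛.⇒ B} → f 𝓛.∘ ε 𝓛.≈ ε 𝓛.∘ L.F₁ (M.F₁ f)
    zig : ∀ {X} → ε {L.F₀ X} 𝓛.∘ L.F₁ (η {X}) 𝓛.≈ 𝓛.id
    zag : ∀ {A} → M.F₁ (ε {A}) 𝓜.∘ η {M.F₀ A} 𝓜.≈ 𝓜.id
    η-monoidal : ∀ {X Y} →
      η {X 𝓜.⊗₀ Y} 𝓜.≈ M.F₁ L.φ 𝓜.∘ M.φ 𝓜.∘ (η 𝓜.⊗₁ η)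
    η-unit : η {𝓜.unit} 𝓜.≈ M.F₁ L.ε 𝓜.∘ M.ε
    ε-monoidal : ∀ {A B} →
      ε {A 𝓛.⊗₀ B} 𝓛.∘ L.F₁ M.φ 𝓛.∘ L.φ 𝓛.≈ (ε 𝓛.⊗₁ ε)
    ε-unit : ε {𝓛.unit} 𝓛.∘ L.F₁ M.ε 𝓛.∘ L.ε 𝓛.≈ 𝓛.id

record IsTerminal (C : Category o ℓ e) (T : Category.Obj C) : Set (o ⊔ ℓ ⊔ e) where
  open Category C
  field
    !        : ∀ {A} → A ⇒ T
    !-unique : ∀ {A} (f : A ⇒ T) → f ≈ !

record IsProduct (C : Category o ℓ e) {A B P : Category.Obj C}
       (p₁ : Category._⇒_ C P A) (p₂ : Category._⇒_ C P B) : Set (o ⊔ ℓ ⊔ e) where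
  open Category C
  field
    ⟨_,_⟩    : ∀ {X} → X ⇒ A → X ⇒ B → X ⇒ P
    project₁ : ∀ {X} {f : X ⇒ A} {g : X ⇒ B} → p₁ ∘ ⟨ f , g ⟩ ≈ f
    project₂ : ∀ {X} {f : X ⇒ A} {g : X ⇒ B} → p₂ ∘ ⟨ f , g ⟩ ≈ g
    unique   : ∀ {X} {f : X ⇒ A} {g : X ⇒ B} {h : X ⇒ P} →
               p₁ ∘ h ≈ f → p₂ ∘ h ≈ g → ⟨ f , g ⟩ ≈ h

record Terminal (C : Category o ℓ e) : Set (o ⊔ ℓ ⊔ e) where
  field
    ⊤          : Category.Obj C
    isTerminal : IsTerminal C ⊤

record BinaryProducts (C : Category o ℓ e) : Set (o ⊔ ℓ ⊔ e) where
  open Category C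
  infixr 7 _&_
  field
    _&_       : Obj → Obj → Obj
    π₁        : ∀ {A B} → (A & B) ⇒ A
    π₂        : ∀ {A B} → (A & B) ⇒ B
    isProduct : ∀ {A B} → IsProduct C (π₁ {A} {B}) π₂

record IsCartesian (𝓜 : SymMonCat o ℓ e) : Set (o ⊔ ℓ ⊔ e) where
  open SymMonCat 𝓜
  field
    unit-terminal : IsTerminal cat unit
  open IsTerminal unit-terminal using (!)
  field
    ⊗-product : ∀ {A B} →
      IsProduct cat (ρ⇒ ∘ (id {A} ⊗₁ ! {B})) (λ⇒ ∘ (! {A} ⊗₁ id {B}))

record Closed (C : SymMonCat o ℓ e) : Set (o ⊔ ℓ ⊔ e) where
  open SymMonCat C
  infixr 5 _⊸_
  field
    _⊸_         : Obj → Obj → Obj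
    ev          : ∀ {B D} → ((B ⊸ D) ⊗₀ B) ⇒ D
    curry       : ∀ {A B D} → (A ⊗₀ B) ⇒ D → A ⇒ (B ⊸ D)
    ev-curry    : ∀ {A B D} {f : (A ⊗₀ B) ⇒ D} → ev ∘ (curry f ⊗₁ id) ≈ f
    curry-unique : ∀ {A B D} {f : (A ⊗₀ B) ⇒ D} {g : A ⇒ (B ⊸ D)} →
                   ev ∘ (g ⊗₁ id) ≈ f → g ≈ curry f

record StarAutonomous (C : SymMonCat o ℓ e) : Set (o ⊔ ℓ ⊔ e) where
  open SymMonCat C
  field
    closed : Closed C
  open Closed closed
  field
    ⊥ : Obj
  canonical : ∀ {A} → A ⇒ ((A ⊸ ⊥) ⊸ ⊥)
  canonical = curry (ev ∘ σ)
  field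
    canonical⁻¹ : ∀ {A} → ((A ⊸ ⊥) ⊸ ⊥) ⇒ A
    canonical-isoˡ : ∀ {A} → canonical⁻¹ ∘ canonical {A} ≈ id
    canonical-isoʳ : ∀ {A} → canonical {A} ∘ canonical⁻¹ ≈ id

record LinearModel (o' ℓ' e' : Level) (𝓛 : SymMonCat o ℓ e)
       : Set (o ⊔ ℓ ⊔ e ⊔ lsuc (o' ⊔ ℓ' ⊔ e')) where
  field
    starAutonomous : StarAutonomous 𝓛
    products       : BinaryProducts (SymMonCat.cat 𝓛)
    terminal       : Terminal (SymMonCat.cat 𝓛)
    𝓜              : SymMonCat o' ℓ' e'
    𝓜-cartesian    : IsCartesian 𝓜
    L              : SymMonFunctor 𝓜 𝓛
    M              : SymMonFunctor 𝓛 𝓜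
    adjunction     : SymMonAdjunction L M

module _ (C : Category o ℓ e) where
  open Category C
  open HomReasoning

  record InvObj : Set (o ⊔ ℓ ⊔ e) where
    constructor _,_,_
    field
      obj  : Obj
      invs : ℤ → obj ⇒ obj
      invol : ∀ k → invs k ∘ invs k ≈ id

  record InvHom (X Y : InvObj) : Set (ℓ ⊔ e) where
    constructor _,_
    private
      module X = InvObj X
      module Y = InvObj Y
    field
      arr : X.obj ⇒ Y.obj
      commutes : ∀ k → Y.invs k ∘ arr ∘ X.invs k ≈ arr

  toComm : ∀ {A B} {s : A ⇒ A} {t : B ⇒ B} {f : A ⇒ B} → t ∘ t ≈ id →
         t ∘ f ∘ s ≈ f → f ∘ s ≈ t ∘ f
  toComm {s = s} {t} {f} tt c = begin
    f ∘ s             ≈⟨ ≈-sym identityˡ ⟩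
    id ∘ f ∘ s        ≈⟨ ∘-resp-≈ (≈-sym tt) ≈-refl ⟩
    (t ∘ t) ∘ f ∘ s   ≈⟨ assoc ⟩
    t ∘ t ∘ f ∘ s     ≈⟨ ∘-resp-≈ ≈-refl c ⟩
    t ∘ f             ∎

  fromComm : ∀ {A B} {s : A ⇒ A} {t : B ⇒ B} {f : A ⇒ B} → t ∘ t ≈ id →
             f ∘ s ≈ t ∘ f → t ∘ f ∘ s ≈ f
  fromComm {s = s} {t} {f} tt c = begin
    t ∘ f ∘ s       ≈⟨ ∘-resp-≈ ≈-refl c ⟩
    t ∘ t ∘ f       ≈⟨ ≈-sym assoc ⟩
    (t ∘ t) ∘ f     ≈⟨ ∘-resp-≈ tt ≈-refl ⟩
    id ∘ f          ≈⟨ identityˡ ⟩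
    f               ∎

  InvCat : Category (o ⊔ ℓ ⊔ e) (ℓ ⊔ e) e
  InvCat = record
    { Obj = InvObj
    ; _⇒_ = InvHom
    ; _≈_ = λ f g → InvHom.arr f ≈ InvHom.arr g
    ; id = λ {X} → id , λ k → fromComm (InvObj.invol X k)
                              (≈-trans identityˡ (≈-sym identityʳ))
    ; _∘_ = λ {X} {Y} {Z} g f → (InvHom.arr g ∘ InvHom.arr f) ,
        λ k → fromComm (InvObj.invol Z k) (comp-comm {X} {Y} {Z} g f k)
    ; equiv = record { refl = ≈-refl ; sym = ≈-sym ; trans = ≈-trans }
    ; ∘-resp-≈ = ∘-resp-≈
    ; assoc = assoc
    ; identityˡ = identityˡ
    ; identityʳ = identityʳ
    }
    where
    comp-comm : ∀ {X Y Z} (g : InvHom Y Z) (f : InvHom X Y) k →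
      (InvHom.arr g ∘ InvHom.arr f) ∘ InvObj.invs X k
        ≈ InvObj.invs Z k ∘ InvHom.arr g ∘ InvHom.arr f
    comp-comm {X} {Y} {Z} (g , cg) (f , cf) k = begin
      (g ∘ f) ∘ s      ≈⟨ assoc ⟩
      g ∘ f ∘ s        ≈⟨ ∘-resp-≈ ≈-refl (toComm (InvObj.invol Y k) (cf k)) ⟩
      g ∘ t ∘ f        ≈⟨ ≈-sym assoc ⟩
      (g ∘ t) ∘ f      ≈⟨ ∘-resp-≈ (toComm (InvObj.invol Z k) (cg k)) ≈-refl ⟩
      (u ∘ g) ∘ f      ≈⟨ assoc ⟩
      u ∘ g ∘ f        ∎
      where
      s = InvObj.invs X k
      t = InvObj.invs Y k
      u = InvObj.invs Z k

module _ {C : Category o ℓ e} where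
  open Category C
  open HomReasoning

  mkInvHom : ∀ {X Y : InvObj C} (f : InvObj.obj X ⇒ InvObj.obj Y) →
             (∀ k → f ∘ InvObj.invs X k ≈ InvObj.invs Y k ∘ f) → InvHom C X Y
  mkInvHom {X} {Y} f c = f , λ k → fromComm C (InvObj.invol Y k) (c k)

  invComm : ∀ {A B} {s : A ⇒ A} {t : B ⇒ B} {φ : A ⇒ B} {ψ : B ⇒ A} →
            φ ∘ s ≈ t ∘ φ → ψ ∘ φ ≈ id → φ ∘ ψ ≈ id → ψ ∘ t ≈ s ∘ ψ
  invComm {s = s} {t} {φ} {ψ} c l r = begin
    ψ ∘ t                 ≈⟨ ≈-sym identityʳ ⟩
    (ψ ∘ t) ∘ id          ≈⟨ ∘-resp-≈ ≈-refl (≈-sym r) ⟩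
    (ψ ∘ t) ∘ φ ∘ ψ       ≈⟨ assoc ⟩
    ψ ∘ t ∘ φ ∘ ψ         ≈⟨ ∘-resp-≈ ≈-refl (≈-sym assoc) ⟩
    ψ ∘ (t ∘ φ) ∘ ψ       ≈⟨ ∘-resp-≈ ≈-refl (∘-resp-≈ (≈-sym c) ≈-refl) ⟩
    ψ ∘ (φ ∘ s) ∘ ψ       ≈⟨ ∘-resp-≈ ≈-refl assoc ⟩
    ψ ∘ φ ∘ s ∘ ψ         ≈⟨ ≈-sym assoc ⟩
    (ψ ∘ φ) ∘ s ∘ ψ       ≈⟨ ∘-resp-≈ l ≈-refl ⟩
    id ∘ s ∘ ψ            ≈⟨ identityˡ ⟩
    s ∘ ψ                 ∎

module _ (𝓐 : SymMonCat o ℓ e) where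
  private
    module A = SymMonCat 𝓐
    open A using (_∘_; _≈_; id; _⊗₀_; _⊗₁_; ≈-refl; ≈-sym; ≈-trans; ∘-resp-≈)
    open A.HomReasoning
    ICat = InvCat A.cat
    I = InvObj A.cat

    _⊗I_ : I → I → I
    (X , s , p) ⊗I (Y , t , q) = (X ⊗₀ Y) , (λ k → s k ⊗₁ t k) , λ k → begin
      (s k ⊗₁ t k) ∘ (s k ⊗₁ t k)  ≈⟨ ≈-sym A.⊗-homomorphism ⟩
      (s k ∘ s k) ⊗₁ (t k ∘ t k)   ≈⟨ A.⊗-resp-≈ (p k) (q k) ⟩
      id ⊗₁ id                     ≈⟨ A.⊗-identity ⟩
      id                           ∎

    unitI : I
    unitI = A.unit , (λ _ → id) , λ _ → A.identityˡ

    tensorHom : ∀ {X X' Y Y'} → InvHom A.cat X X' → InvHom A.cat Y Y' →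
                InvHom A.cat (X ⊗I Y) (X' ⊗I Y')
    tensorHom {X} {X'} {Y} {Y'} (f , cf) (g , cg) = mkInvHom (f ⊗₁ g) λ k → begin
      (f ⊗₁ g) ∘ (s k ⊗₁ t k)    ≈⟨ ≈-sym A.⊗-homomorphism ⟩
      (f ∘ s k) ⊗₁ (g ∘ t k)     ≈⟨ A.⊗-resp-≈ (toComm A.cat (InvObj.invol X' k) (cf k))
                                               (toComm A.cat (InvObj.invol Y' k) (cg k)) ⟩
      (s' k ∘ f) ⊗₁ (t' k ∘ g)   ≈⟨ A.⊗-homomorphism ⟩
      (s' k ⊗₁ t' k) ∘ (f ⊗₁ g)  ∎
      where
      s = InvObj.invs X
      t = InvObj.invs Y
      s' = InvObj.invs X'
      t' = InvObj.invs Y'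

    λI⇒ : ∀ {X} → InvHom A.cat (unitI ⊗I X) X
    λI⇒ = mkInvHom A.λ⇒ λ k → A.λ-natural
    λI⇐ : ∀ {X} → InvHom A.cat X (unitI ⊗I X)
    λI⇐ = mkInvHom A.λ⇐ λ k → invComm {C = A.cat} A.λ-natural A.λ-isoˡ A.λ-isoʳ
    ρI⇒ : ∀ {X} → InvHom A.cat (X ⊗I unitI) X
    ρI⇒ = mkInvHom A.ρ⇒ λ k → A.ρ-natural
    ρI⇐ : ∀ {X} → InvHom A.cat X (X ⊗I unitI)
    ρI⇐ = mkInvHom A.ρ⇐ λ k → invComm {C = A.cat} A.ρ-natural A.ρ-isoˡ A.ρ-isoʳ
    αI⇒ : ∀ {X Y Z} → InvHom A.cat ((X ⊗I Y) ⊗I Z) (X ⊗I (Y ⊗I Z))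
    αI⇒ = mkInvHom A.α⇒ λ k → A.α-natural
    αI⇐ : ∀ {X Y Z} → InvHom A.cat (X ⊗I (Y ⊗I Z)) ((X ⊗I Y) ⊗I Z)
    αI⇐ = mkInvHom A.α⇐ λ k → invComm {C = A.cat} A.α-natural A.α-isoˡ A.α-isoʳ
    σI : ∀ {X Y} → InvHom A.cat (X ⊗I Y) (Y ⊗I X)
    σI = mkInvHom A.σ λ k → A.σ-natural

    InvMonoidal : Monoidal ICat
    InvMonoidal = record
      { _⊗₀_ = _⊗I_
      ; _⊗₁_ = tensorHom
      ; ⊗-identity = A.⊗-identity
      ; ⊗-homomorphism = A.⊗-homomorphism
      ; ⊗-resp-≈ = A.⊗-resp-≈
      ; unit = unitI
      ; λ⇒ = λI⇒ ; λ⇐ = λI⇐ ; λ-isoˡ = A.λ-isoˡ ; λ-isoʳ = A.λ-isoʳ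
      ; λ-natural = A.λ-natural
      ; ρ⇒ = ρI⇒ ; ρ⇐ = ρI⇐ ; ρ-isoˡ = A.ρ-isoˡ ; ρ-isoʳ = A.ρ-isoʳ
      ; ρ-natural = A.ρ-natural
      ; α⇒ = αI⇒ ; α⇐ = αI⇐ ; α-isoˡ = A.α-isoˡ ; α-isoʳ = A.α-isoʳ
      ; α-natural = A.α-natural
      ; triangle = A.triangle
      ; pentagon = A.pentagon
      }

    InvSymmetric : Symmetric InvMonoidal
    InvSymmetric = record
      { σ = σI
      ; σ-natural = A.σ-natural
      ; σ-involutive = A.σ-involutive
      ; hexagon = A.hexagon
      }

  InvSMC : SymMonCat (o ⊔ ℓ ⊔ e) (ℓ ⊔ e) e
  InvSMC = record { cat = ICat ; monoidal = InvMonoidal ; symmetric = InvSymmetric }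

-- Inv is a 2-functor on symmetric monoidal categories, so it carries the
-- symmetric monoidal adjunction L ⊣ M to a symmetric monoidal adjunction
-- Inv L ⊣ Inv M; what remains is that Inv preserves the extra structure on
-- both sides.  Limits are created by the forgetful functor Inv 𝓐 → 𝓐: a
-- product A & B carries the involutions s & t, and any involutions on a
-- terminal object make it terminal.  The internal hom A ⊸ B carries the
-- conjugation involutions f ↦ t ∘ f ∘ s, which make evaluation and currying
-- equivariant; the canonical map into the double dual is then equivariant,
-- and so is its inverse.
module Submission where

open import Level using (Level; _⊔_)
open import Data.Integer using (ℤ)
open import Defs

private
  variable
    o ℓ e o' ℓ' e' : Level

module Reasoning (C : Category o ℓ e) where
  open Category C public
  open HomReasoning public

  infixr 4 refl⟩∘⟨_
  infixl 5 _⟩∘⟨refl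

  refl⟩∘⟨_ : ∀ {A B D} {f : B ⇒ D} {g i : A ⇒ B} → g ≈ i → f ∘ g ≈ f ∘ i
  refl⟩∘⟨_ = ∘-resp-≈ ≈-refl

  _⟩∘⟨refl : ∀ {A B D} {f h : B ⇒ D} {g : A ⇒ B} → f ≈ h → f ∘ g ≈ h ∘ g
  p ⟩∘⟨refl = ∘-resp-≈ p ≈-refl

  pullˡ : ∀ {A B D E} {a : D ⇒ E} {b : B ⇒ D} {c : B ⇒ E} {f : A ⇒ B} →
          a ∘ b ≈ c → a ∘ (b ∘ f) ≈ c ∘ f
  pullˡ ab = ≈-trans (≈-sym assoc) (ab ⟩∘⟨refl)

  cancelˡ : ∀ {A B} {a : B ⇒ B} {f : A ⇒ B} → a ∘ a ≈ id → a ∘ (a ∘ f) ≈ f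
  cancelˡ aa = ≈-trans (pullˡ aa) identityˡ

  Equivariant : ∀ {A B} → A ⇒ A → B ⇒ B → A ⇒ B → Set e
  Equivariant s t f = f ∘ s ≈ t ∘ f

  equivariant-involution : ∀ {A B} {a : A ⇒ A} {s : B ⇒ B} {p : A ⇒ B} →
                           Equivariant a s p → s ∘ s ≈ id → p ∘ (a ∘ a) ≈ p ∘ id
  equivariant-involution {a = a} {s} {p} pa ss = begin
    p ∘ (a ∘ a)    ≈⟨ pullˡ pa ⟩
    (s ∘ p) ∘ a    ≈⟨ assoc ⟩
    s ∘ (p ∘ a)    ≈⟨ refl⟩∘⟨ pa ⟩
    s ∘ (s ∘ p)    ≈⟨ cancelˡ ss ⟩
    p              ≈˘⟨ identityʳ ⟩
    p ∘ id         ∎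

  !-equivariant : ∀ {T X} (isT : IsTerminal C T) {s : X ⇒ X} {t : T ⇒ T} →
                  Equivariant s t (IsTerminal.! isT)
  !-equivariant isT = ≈-trans (!-unique _) (≈-sym (!-unique _))
    where open IsTerminal isT

  module _ {A B P} {p₁ : P ⇒ A} {p₂ : P ⇒ B} (isP : IsProduct C p₁ p₂) where
    open IsProduct isP

    product-jointly-monic : ∀ {X} {h h' : X ⇒ P} →
                            p₁ ∘ h ≈ p₁ ∘ h' → p₂ ∘ h ≈ p₂ ∘ h' → h ≈ h'
    product-jointly-monic e₁ e₂ = ≈-trans (≈-sym (unique e₁ e₂)) (unique ≈-refl ≈-refl)

    ⟨⟩-equivariant : ∀ {X} {sA : A ⇒ A} {sB : B ⇒ B} {sP : P ⇒ P} {x : X ⇒ X}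
                     {f : X ⇒ A} {g : X ⇒ B} →
                     Equivariant sP sA p₁ → Equivariant sP sB p₂ →
                     Equivariant x sA f → Equivariant x sB g →
                     Equivariant x sP ⟨ f , g ⟩
    ⟨⟩-equivariant {X} {x = x} {f} {g} p₁-eq p₂-eq f-eq g-eq =
      product-jointly-monic (component p₁-eq f-eq project₁)
                            (component p₂-eq g-eq project₂)
      where
      component : ∀ {D} {p : P ⇒ D} {s : D ⇒ D} {sP : P ⇒ P} {k : X ⇒ D} →
                  Equivariant sP s p → Equivariant x s k → p ∘ ⟨ f , g ⟩ ≈ k →
                  p ∘ (⟨ f , g ⟩ ∘ x) ≈ p ∘ (sP ∘ ⟨ f , g ⟩)
      component {p = p} {s} {sP} {k} p-eq k-eq pk = begin
        p ∘ (⟨ f , g ⟩ ∘ x)     ≈⟨ pullˡ pk ⟩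
        k ∘ x                   ≈⟨ k-eq ⟩
        s ∘ k                   ≈˘⟨ refl⟩∘⟨ pk ⟩
        s ∘ (p ∘ ⟨ f , g ⟩)     ≈˘⟨ assoc ⟩
        (s ∘ p) ∘ ⟨ f , g ⟩     ≈˘⟨ pullˡ p-eq ⟩
        p ∘ (sP ∘ ⟨ f , g ⟩)    ∎

arr-equivariant : {C : Category o ℓ e} {X Y : InvObj C} (f : InvHom C X Y) (k : ℤ) →
                  Reasoning.Equivariant C (InvObj.invs X k) (InvObj.invs Y k) (InvHom.arr f)
arr-equivariant {C = C} {Y = Y} f k = toComm C (InvObj.invol Y k) (InvHom.commutes f k)

module _ {C : Category o ℓ e} {D : Category o' ℓ' e'} (G : Functor C D) where
  private
    module C = Reasoning C
    module D = Reasoning D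
  open Functor G

  F-involutive : ∀ {A} {s : A C.⇒ A} → s C.∘ s C.≈ C.id → F₁ s D.∘ F₁ s D.≈ D.id
  F-involutive ss = D.≈-trans (D.≈-sym homomorphism) (D.≈-trans (F-resp-≈ ss) identity)

  F-equivariant : ∀ {A B} {s : A C.⇒ A} {t : B C.⇒ B} {f : A C.⇒ B} →
                  C.Equivariant s t f → D.Equivariant (F₁ s) (F₁ t) (F₁ f)
  F-equivariant eq = D.≈-trans (D.≈-sym homomorphism) (D.≈-trans (F-resp-≈ eq) homomorphism)

  InvFunctor : Functor (InvCat C) (InvCat D)
  InvFunctor = record
    { F₀ = λ X → F₀ (InvObj.obj X) , (λ k → F₁ (InvObj.invs X k)) ,
                 λ k → F-involutive (InvObj.invol X k)
    ; F₁ = λ {X} {Y} f → mkInvHom (F₁ (InvHom.arr f)) λ k →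
             F-equivariant (arr-equivariant f k)
    ; identity = identity
    ; homomorphism = homomorphism
    ; F-resp-≈ = F-resp-≈
    }

module _ {C : SymMonCat o ℓ e} {D : SymMonCat o' ℓ' e'} (G : SymMonFunctor C D) where
  private
    module C = SymMonCat C
    module D = Reasoning (SymMonCat.cat D)
  open SymMonFunctor G

  InvSymMonFunctor : SymMonFunctor (InvSMC C) (InvSMC D)
  InvSymMonFunctor = record
    { F = InvFunctor F
    ; φ = mkInvHom φ λ k → φ-natural
    ; ε = mkInvHom ε λ k → D.begin
        ε D.∘ D.id        D.≈⟨ D.identityʳ ⟩
        ε                 D.≈˘⟨ D.identityˡ ⟩
        D.id D.∘ ε        D.≈˘⟨ identity D.⟩∘⟨refl ⟩
        F₁ C.id D.∘ ε     D.∎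
    ; φ-natural = φ-natural
    ; associativity = associativity
    ; unitaryˡ = unitaryˡ
    ; unitaryʳ = unitaryʳ
    ; braiding-compat = braiding-compat
    }

InvSymMonAdjunction : {𝓜 : SymMonCat o ℓ e} {𝓛 : SymMonCat o' ℓ' e'}
                      {L : SymMonFunctor 𝓜 𝓛} {M : SymMonFunctor 𝓛 𝓜} →
                      SymMonAdjunction L M →
                      SymMonAdjunction (InvSymMonFunctor L) (InvSymMonFunctor M)
InvSymMonAdjunction {𝓛 = 𝓛} adj = record
  { η = mkInvHom η λ k → η-natural
  ; ε = mkInvHom ε λ k → SymMonCat.≈-sym 𝓛 ε-natural
  ; η-natural = η-natural
  ; ε-natural = ε-natural
  ; zig = zig
  ; zag = zag
  ; η-monoidal = η-monoidal
  ; η-unit = η-unit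
  ; ε-monoidal = ε-monoidal
  ; ε-unit = ε-unit
  }
  where open SymMonAdjunction adj

module _ {C : Category o ℓ e} where
  open Reasoning C

  trivialInvolutions : Obj → InvObj C
  trivialInvolutions A = A , (λ _ → id) , λ _ → identityˡ

  invHom-inverse : ∀ {X Y : InvObj C} (f : InvHom C X Y) {g : InvObj.obj Y ⇒ InvObj.obj X} →
                   g ∘ InvHom.arr f ≈ id → InvHom.arr f ∘ g ≈ id → InvHom C Y X
  invHom-inverse {X} {Y} f {g} gf fg = mkInvHom {X = Y} {Y = X} g λ k →
    invComm {C = C} (arr-equivariant f k) gf fg

  invIsTerminal : (X : InvObj C) → IsTerminal C (InvObj.obj X) → IsTerminal (InvCat C) X
  invIsTerminal X isT = record
    { ! = mkInvHom ! λ k → !-equivariant isT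
    ; !-unique = λ f → !-unique (InvHom.arr f)
    }
    where open IsTerminal isT

  invTerminal : Terminal C → Terminal (InvCat C)
  invTerminal T = record
    { ⊤ = trivialInvolutions ⊤
    ; isTerminal = invIsTerminal (trivialInvolutions ⊤) isTerminal
    }
    where open Terminal T

  invIsProduct : ∀ {A B P : InvObj C} {p₁ : InvHom C P A} {p₂ : InvHom C P B} →
                 IsProduct C (InvHom.arr p₁) (InvHom.arr p₂) → IsProduct (InvCat C) p₁ p₂
  invIsProduct {p₁ = p₁} {p₂} isP = record
    { ⟨_,_⟩ = λ f g → mkInvHom ⟨ InvHom.arr f , InvHom.arr g ⟩ λ k →
        ⟨⟩-equivariant isP (arr-equivariant p₁ k) (arr-equivariant p₂ k)
                           (arr-equivariant f k) (arr-equivariant g k)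
    ; project₁ = project₁
    ; project₂ = project₂
    ; unique = unique
    }
    where open IsProduct isP

  invBinaryProducts : BinaryProducts C → BinaryProducts (InvCat C)
  invBinaryProducts products = record
    { _&_ = _&I_
    ; π₁ = λ {X} {Y} → mkInvHom {X = X &I Y} {Y = X} π₁ λ k → project₁
    ; π₂ = λ {X} {Y} → mkInvHom {X = X &I Y} {Y = Y} π₂ λ k → project₂
    ; isProduct = invIsProduct isProduct
    }
    where
    open BinaryProducts products
    module P {A B} = IsProduct (isProduct {A} {B})
    open P

    _&I_ : InvObj C → InvObj C → InvObj C
    (A , s , ss) &I (B , t , tt) = (A & B) , (λ k → ⟨ s k ∘ π₁ , t k ∘ π₂ ⟩) , λ k →
      product-jointly-monic isProduct (equivariant-involution project₁ (ss k))
                                      (equivariant-involution project₂ (tt k))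

invIsCartesian : (𝓜 : SymMonCat o ℓ e) → IsCartesian 𝓜 → IsCartesian (InvSMC 𝓜)
invIsCartesian 𝓜 cartesian = record
  { unit-terminal = invIsTerminal _ unit-terminal
  ; ⊗-product = invIsProduct ⊗-product
  }
  where open IsCartesian cartesian

module Conjugation (𝓛 : SymMonCat o ℓ e) (closed : Closed 𝓛) where
  open SymMonCat 𝓛 using (_⊗₀_; _⊗₁_; ⊗-homomorphism; ⊗-resp-≈; ⊗-identity; cat)
  open Reasoning cat
  open Closed closed

  conj : ∀ {A B} → A ⇒ A → B ⇒ B → (A ⊸ B) ⇒ (A ⊸ B)
  conj s t = curry (t ∘ ev ∘ (id ⊗₁ s))

  uncurry-injective : ∀ {A B D} {g h : A ⇒ (B ⊸ D)} →
                      ev ∘ (g ⊗₁ id) ≈ ev ∘ (h ⊗₁ id) → g ≈ h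
  uncurry-injective eq = ≈-trans (curry-unique eq) (≈-sym (curry-unique ≈-refl))

  ev-∘-⊗ : ∀ {A A' B B' B'' D}
           {h : A' ⇒ (B ⊸ D)} {k : A ⇒ A'} {g : B' ⇒ B} {g' : B'' ⇒ B'} →
           ev ∘ ((h ∘ k) ⊗₁ (g ∘ g')) ≈ (ev ∘ (h ⊗₁ g)) ∘ (k ⊗₁ g')
  ev-∘-⊗ = ≈-trans (refl⟩∘⟨ ⊗-homomorphism) (≈-sym assoc)

  ev-curry-⊗ : ∀ {A B B' D} {f : (A ⊗₀ B) ⇒ D} {g : B' ⇒ B} →
               ev ∘ (curry f ⊗₁ g) ≈ f ∘ (id ⊗₁ g)
  ev-curry-⊗ {f = f} {g} = begin
    ev ∘ (curry f ⊗₁ g)                 ≈˘⟨ refl⟩∘⟨ ⊗-resp-≈ identityʳ identityˡ ⟩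
    ev ∘ ((curry f ∘ id) ⊗₁ (id ∘ g))   ≈⟨ ev-∘-⊗ ⟩
    (ev ∘ (curry f ⊗₁ id)) ∘ (id ⊗₁ g)  ≈⟨ ev-curry ⟩∘⟨refl ⟩
    f ∘ (id ⊗₁ g)                       ∎

  ev-conj : ∀ {A B} {s : A ⇒ A} {t : B ⇒ B} → s ∘ s ≈ id →
            Equivariant (conj s t ⊗₁ s) t ev
  ev-conj {s = s} {t} ss = begin
    ev ∘ (conj s t ⊗₁ s)                      ≈⟨ ev-curry-⊗ ⟩
    (t ∘ ev ∘ (id ⊗₁ s)) ∘ (id ⊗₁ s)          ≈⟨ assoc ⟩
    t ∘ (ev ∘ (id ⊗₁ s)) ∘ (id ⊗₁ s)          ≈⟨ refl⟩∘⟨ assoc ⟩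
    t ∘ ev ∘ ((id ⊗₁ s) ∘ (id ⊗₁ s))          ≈˘⟨ refl⟩∘⟨ refl⟩∘⟨ ⊗-homomorphism ⟩
    t ∘ ev ∘ ((id ∘ id) ⊗₁ (s ∘ s))           ≈⟨ refl⟩∘⟨ refl⟩∘⟨ ⊗-resp-≈ identityˡ ss ⟩
    t ∘ ev ∘ (id ⊗₁ id)                       ≈⟨ refl⟩∘⟨ refl⟩∘⟨ ⊗-identity ⟩
    t ∘ ev ∘ id                               ≈⟨ refl⟩∘⟨ identityʳ ⟩
    t ∘ ev                                    ∎

  conj-involutive : ∀ {A B} {s : A ⇒ A} {t : B ⇒ B} → s ∘ s ≈ id → t ∘ t ≈ id →
                    conj s t ∘ conj s t ≈ id
  conj-involutive {s = s} {t} ss tt = uncurry-injective (begin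
    ev ∘ ((c ∘ c) ⊗₁ id)         ≈˘⟨ refl⟩∘⟨ ⊗-resp-≈ ≈-refl ss ⟩
    ev ∘ ((c ∘ c) ⊗₁ (s ∘ s))    ≈⟨ ev-∘-⊗ ⟩
    (ev ∘ (c ⊗₁ s)) ∘ (c ⊗₁ s)   ≈⟨ ev-conj ss ⟩∘⟨refl ⟩
    (t ∘ ev) ∘ (c ⊗₁ s)          ≈⟨ assoc ⟩
    t ∘ (ev ∘ (c ⊗₁ s))          ≈⟨ refl⟩∘⟨ ev-conj ss ⟩
    t ∘ (t ∘ ev)                 ≈⟨ cancelˡ tt ⟩
    ev                           ≈˘⟨ identityʳ ⟩
    ev ∘ id                      ≈˘⟨ refl⟩∘⟨ ⊗-identity ⟩
    ev ∘ (id ⊗₁ id)              ∎)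
    where c = conj s t

  curry-equivariant : ∀ {A B D} {s : A ⇒ A} {t : B ⇒ B} {u : D ⇒ D} {f : (A ⊗₀ B) ⇒ D} →
                      t ∘ t ≈ id → Equivariant (s ⊗₁ t) u f →
                      Equivariant s (conj t u) (curry f)
  curry-equivariant {s = s} {t} {u} {f} tt f-eq = uncurry-injective (begin
    ev ∘ ((curry f ∘ s) ⊗₁ id)          ≈˘⟨ refl⟩∘⟨ ⊗-resp-≈ ≈-refl identityˡ ⟩
    ev ∘ ((curry f ∘ s) ⊗₁ (id ∘ id))   ≈⟨ ev-∘-⊗ ⟩
    (ev ∘ (curry f ⊗₁ id)) ∘ (s ⊗₁ id)  ≈⟨ ev-curry ⟩∘⟨refl ⟩
    f ∘ (s ⊗₁ id)                       ≈˘⟨ conj-side ⟩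
    ev ∘ ((conj t u ∘ curry f) ⊗₁ id)   ∎)
    where
    conj-side : ev ∘ ((conj t u ∘ curry f) ⊗₁ id) ≈ f ∘ (s ⊗₁ id)
    conj-side = begin
      ev ∘ ((conj t u ∘ curry f) ⊗₁ id)         ≈˘⟨ refl⟩∘⟨ ⊗-resp-≈ ≈-refl tt ⟩
      ev ∘ ((conj t u ∘ curry f) ⊗₁ (t ∘ t))    ≈⟨ ev-∘-⊗ ⟩
      (ev ∘ (conj t u ⊗₁ t)) ∘ (curry f ⊗₁ t)   ≈⟨ ev-conj tt ⟩∘⟨refl ⟩
      (u ∘ ev) ∘ (curry f ⊗₁ t)                 ≈⟨ assoc ⟩
      u ∘ (ev ∘ (curry f ⊗₁ t))                 ≈⟨ refl⟩∘⟨ ev-curry-⊗ ⟩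
      u ∘ (f ∘ (id ⊗₁ t))                       ≈⟨ pullˡ (≈-sym f-eq) ⟩
      (f ∘ (s ⊗₁ t)) ∘ (id ⊗₁ t)                ≈⟨ assoc ⟩
      f ∘ ((s ⊗₁ t) ∘ (id ⊗₁ t))                ≈˘⟨ refl⟩∘⟨ ⊗-homomorphism ⟩
      f ∘ ((s ∘ id) ⊗₁ (t ∘ t))                 ≈⟨ refl⟩∘⟨ ⊗-resp-≈ identityʳ tt ⟩
      f ∘ (s ⊗₁ id)                             ∎

module _ (𝓛 : SymMonCat o ℓ e) where
  private
    module 𝓛 = SymMonCat 𝓛
    module Inv𝓛 = SymMonCat (InvSMC 𝓛)

  invClosed : Closed 𝓛 → Closed (InvSMC 𝓛)
  invClosed closed = record
    { _⊸_ = _⊸I_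
    ; ev = λ {X} {Y} → mkInvHom {X = (X ⊸I Y) Inv𝓛.⊗₀ X} {Y = Y} ev λ k →
             ev-conj (InvObj.invol X k)
    ; curry = λ {X} {Y} {Z} f → mkInvHom {X = X} {Y = Y ⊸I Z} (curry (InvHom.arr f)) λ k →
             curry-equivariant (InvObj.invol Y k) (arr-equivariant f k)
    ; ev-curry = ev-curry
    ; curry-unique = curry-unique
    }
    where
    open Closed closed
    open Conjugation 𝓛 closed

    _⊸I_ : InvObj 𝓛.cat → InvObj 𝓛.cat → InvObj 𝓛.cat
    (A , s , ss) ⊸I (B , t , tt) = (A ⊸ B) , (λ k → conj (s k) (t k)) , λ k →
      conj-involutive (ss k) (tt k)

  invStarAutonomous : StarAutonomous 𝓛 → StarAutonomous (InvSMC 𝓛)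
  invStarAutonomous starAutonomous = record
    { closed = invClosed closed
    ; ⊥ = ⊥I
    ; canonical⁻¹ = invHom-inverse invCanonical canonical-isoˡ canonical-isoʳ
    ; canonical-isoˡ = canonical-isoˡ
    ; canonical-isoʳ = canonical-isoʳ
    }
    where
    open StarAutonomous starAutonomous
    open Closed (invClosed closed) using () renaming (_⊸_ to _⊸I_; ev to evI; curry to curryI)

    ⊥I : InvObj 𝓛.cat
    ⊥I = trivialInvolutions ⊥

    -- Its underlying arrow is the canonical map of 𝓛, which is therefore equivariant.
    invCanonical : ∀ {X} → InvHom 𝓛.cat X ((X ⊸I ⊥I) ⊸I ⊥I)
    invCanonical = curryI (evI Inv𝓛.∘ Inv𝓛.σ)

mainTheorem1 : ∀ {o ℓ e o' ℓ' e' : Level} (𝓛 : SymMonCat o ℓ e) →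
               LinearModel o' ℓ' e' 𝓛 →
               LinearModel (o' ⊔ ℓ' ⊔ e') (ℓ' ⊔ e') e' (InvSMC 𝓛)
mainTheorem1 𝓛 model = record
  { starAutonomous = invStarAutonomous 𝓛 starAutonomous
  ; products = invBinaryProducts products
  ; terminal = invTerminal terminal
  ; 𝓜 = InvSMC 𝓜
  ; 𝓜-cartesian = invIsCartesian 𝓜 𝓜-cartesian
  ; L = InvSymMonFunctor L
  ; M = InvSymMonFunctor M
  ; adjunction = InvSymMonAdjunction adjunction
  }
  where open LinearModel model
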